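{- Let $T$ be a rooted binary tree with $n$ leaves that has minimal Colless index among all rooted binary trees with $n$ leaves. Then $T$ has minimal Sackin index among all rooted binary trees with $n$ leaves.
   Context: A rooted binary tree with $n\ge2$ leaves is a rooted tree in which the root has degree 2 and every other internal vertex has degree 3 (each internal vertex has exactly two children); the single vertex is the rooted binary tree with one leaf. For a vertex $v$, $\kappa_T(v)$ is the number of leaves descending from $v$ ($1$ if $v$ is a leaf). For an internal vertex $v$ with children $v_1,v_2$, $bal_T(v)=|\kappa_T(v_1)-\kappa_T(v_2)|$; the Colless index is $\mathcal{C}(T)=\sum_{v\text{ internal}} bal_T(v)$, and the Sackin index is $\mathcal{S}(T)=\sum_{u\text{ internal}}\kappa_T(u)$. -}

module Defs where

open import Data.Nat using (ℕ; _+_; _≤_; ∣_-_∣)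
open import Relation.Binary.PropositionalEquality using (_≡_)

data BinTree : Set where
  leaf : BinTree
  node : BinTree → BinTree → BinTree

leaves : BinTree → ℕ
leaves leaf       = 1
leaves (node l r) = leaves l + leaves r

colless : BinTree → ℕ
colless leaf       = 0
colless (node l r) = ∣ leaves l - leaves r ∣ + colless l + colless r

sackin : BinTree → ℕ
sackin leaf       = 0
sackin (node l r) = leaves l + leaves r + sackin l + sackin r

CollessMinimal : ℕ → BinTree → Set
CollessMinimal n T = ∀ (T′ : BinTree) → leaves T′ ≡ n → colless T ≤ colless T′

SackinMinimal : ℕ → BinTree → Set
SackinMinimal n T = ∀ (T′ : BinTree) → leaves T′ ≡ n → sackin T ≤ sackin T′

{-# OPTIONS --safe #-}
-- Since |a − b| + 2 min(a, b) = a + b, the Sackin index is the Colless index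
-- plus minSum, the sum over internal vertices of twice the smaller subtree
-- size.  The maximally balanced tree B with n leaves (subtree sizes ⌊m/2⌋ and
-- ⌈m/2⌉ at every vertex) both minimises Sackin and maximises minSum among trees
-- with n leaves: by strong induction on a + b, the halves of a and of b pair up
-- into the halves of a + b, which gives the inequalities comparing B_{a+b} with
-- a root over B_a and B_b.  So a Colless-minimal T satisfies
-- S(T) = C(T) + minSum(T) ≤ C(B) + minSum(B) = S(B) ≤ S(T′).
module Submission where

open import Defs
open import Data.Nat using (ℕ; zero; suc; _+_; _≤_; _<_; z≤n; s≤s; _⊓_; ∣_-_∣; ⌊_/2⌋; ⌈_/2⌉)
open import Data.Nat.Properties
open import Data.Nat.Induction using (<-rec)
open import Data.Nat.Tactic.RingSolver using (solve-∀)
open import Data.Product using (_×_; _,_; proj₁; proj₂)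
open import Data.Sum using (_⊎_; inj₁; inj₂)
open import Algebra.Properties.CommutativeSemigroup +-commutativeSemigroup
  using (interchange; xy∙z≈xz∙y)
open import Relation.Binary.PropositionalEquality

minSum : BinTree → ℕ
minSum leaf       = 0
minSum (node l r) = (leaves l ⊓ leaves r) + (leaves l ⊓ leaves r) + minSum l + minSum r

∣m-n∣+min-doubled : ∀ m n → ∣ m - n ∣ + (m ⊓ n + m ⊓ n) ≡ m + n
∣m-n∣+min-doubled zero    n       = +-identityʳ n
∣m-n∣+min-doubled (suc m) zero    = refl
∣m-n∣+min-doubled (suc m) (suc n) = begin
  ∣ m - n ∣ + (suc (m ⊓ n) + suc (m ⊓ n)) ≡⟨ shift ∣ m - n ∣ (m ⊓ n) ⟩
  suc (suc (∣ m - n ∣ + (m ⊓ n + m ⊓ n))) ≡⟨ cong (λ k → suc (suc k)) (∣m-n∣+min-doubled m n) ⟩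
  suc (suc (m + n))                       ≡⟨ cong suc (sym (+-suc m n)) ⟩
  suc m + suc n                           ∎
  where
  open ≡-Reasoning
  shift : ∀ d k → d + (suc k + suc k) ≡ suc (suc (d + (k + k)))
  shift = solve-∀

sackin≡colless+minSum : ∀ T → sackin T ≡ colless T + minSum T
sackin≡colless+minSum leaf       = refl
sackin≡colless+minSum (node l r) = begin
  leaves l + leaves r + sackin l + sackin r
    ≡⟨ cong₂ (λ x y → leaves l + leaves r + x + y) (sackin≡colless+minSum l) (sackin≡colless+minSum r) ⟩
  leaves l + leaves r + (colless l + minSum l) + (colless r + minSum r)
    ≡⟨ cong (λ x → x + (colless l + minSum l) + (colless r + minSum r))
            (sym (∣m-n∣+min-doubled (leaves l) (leaves r))) ⟩
  ∣ leaves l - leaves r ∣ + (μ + μ) + (colless l + minSum l) + (colless r + minSum r)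
    ≡⟨ regroup ∣ leaves l - leaves r ∣ (μ + μ) (colless l) (minSum l) (colless r) (minSum r) ⟩
  colless (node l r) + minSum (node l r) ∎
  where
  open ≡-Reasoning
  μ : ℕ
  μ = leaves l ⊓ leaves r
  regroup : ∀ d m cl ml cr mr → d + m + (cl + ml) + (cr + mr) ≡ (d + cl + cr) + (m + ml + mr)
  regroup = solve-∀

-- grow swaps the subtrees and grows the smaller one, so iterating it from a
-- leaf keeps subtrees of sizes ⌊m/2⌋ and ⌈m/2⌉ below every vertex.
grow : BinTree → BinTree
grow leaf       = node leaf leaf
grow (node l r) = node r (grow l)

-- balanced 0 = leaf is a junk value.
balanced : ℕ → BinTree
balanced zero          = leaf
balanced (suc zero)    = leaf
balanced (suc (suc n)) = grow (balanced (suc n))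

leaves-grow : ∀ T → leaves (grow T) ≡ suc (leaves T)
leaves-grow leaf       = refl
leaves-grow (node l r) = begin
  leaves r + leaves (grow l) ≡⟨ cong (leaves r +_) (leaves-grow l) ⟩
  leaves r + suc (leaves l)  ≡⟨ +-suc (leaves r) (leaves l) ⟩
  suc (leaves r + leaves l)  ≡⟨ cong suc (+-comm (leaves r) (leaves l)) ⟩
  suc (leaves l + leaves r)  ∎
  where open ≡-Reasoning

leaves-balanced : ∀ {n} → 1 ≤ n → leaves (balanced n) ≡ n
leaves-balanced {suc zero}    _ = refl
leaves-balanced {suc (suc n)} _ =
  trans (leaves-grow (balanced (suc n))) (cong suc (leaves-balanced {suc n} (s≤s z≤n)))

1≤leaves : ∀ T → 1 ≤ leaves T
1≤leaves leaf       = s≤s z≤n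
1≤leaves (node l r) = ≤-trans (1≤leaves l) (m≤m+n (leaves l) (leaves r))

data Halves : ℕ → ℕ → Set where
  even : ∀ {p} → Halves p p
  odd  : ∀ {p} → Halves p (suc p)

halves-≤ : ∀ {p q} → Halves p q → p ≤ q
halves-≤ even = ≤-refl
halves-≤ odd  = n≤1+n _

data Halving : ℕ → Set where
  split : ∀ p q → Halves p q → Halving (p + q)

halving : ∀ n → Halving n
halving zero = split 0 0 even
halving (suc n) with halving n
... | split p _ even = subst Halving (+-suc p p) (split p (suc p) odd)
... | split p _ odd  = split (suc p) (suc p) even

balanced-halves : ∀ {p q} → Halves p q → 1 ≤ p → balanced (p + q) ≡ node (balanced p) (balanced q)
balanced-halves {suc zero}    even _ = refl
balanced-halves {suc zero}    odd  _ = refl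
balanced-halves {suc (suc p)} even _ =
  cong grow (balanced-halves {suc p} odd (s≤s z≤n))
balanced-halves {suc (suc p)} odd _ =
  trans (cong (λ n → grow (balanced (suc n))) (+-suc p (suc (suc p))))
        (cong grow (balanced-halves {suc (suc p)} even (s≤s z≤n)))

sackinᵇ : ℕ → ℕ
sackinᵇ n = sackin (balanced n)

minSumᵇ : ℕ → ℕ
minSumᵇ n = minSum (balanced n)

sackinᵇ-halves : ∀ {n p q} → Halves p q → 1 ≤ p → n ≡ p + q →
                 sackinᵇ n ≡ n + sackinᵇ p + sackinᵇ q
sackinᵇ-halves {p = p} {q} h 1≤p refl = begin
  sackin (balanced (p + q))
    ≡⟨ cong sackin (balanced-halves h 1≤p) ⟩
  leaves (balanced p) + leaves (balanced q) + sackinᵇ p + sackinᵇ q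
    ≡⟨ cong₂ (λ x y → x + y + sackinᵇ p + sackinᵇ q) (leaves-balanced 1≤p) (leaves-balanced 1≤q) ⟩
  p + q + sackinᵇ p + sackinᵇ q ∎
  where
  open ≡-Reasoning
  1≤q : 1 ≤ q
  1≤q = ≤-trans 1≤p (halves-≤ h)

minSumᵇ-halves : ∀ {n p q} → Halves p q → n ≡ p + q →
                 minSumᵇ n ≡ p + p + minSumᵇ p + minSumᵇ q
minSumᵇ-halves {p = zero}  even refl = refl
minSumᵇ-halves {p = zero}  odd  refl = refl
minSumᵇ-halves {p = suc p} {q} h refl = begin
  minSum (balanced (suc p + q))
    ≡⟨ cong minSum (balanced-halves h (s≤s z≤n)) ⟩
  μ + μ + minSumᵇ (suc p) + minSumᵇ q
    ≡⟨ cong (λ x → x + x + minSumᵇ (suc p) + minSumᵇ q) μ≡p ⟩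
  suc p + suc p + minSumᵇ (suc p) + minSumᵇ q ∎
  where
  open ≡-Reasoning
  μ : ℕ
  μ = leaves (balanced (suc p)) ⊓ leaves (balanced q)
  μ≡p : μ ≡ suc p
  μ≡p = trans (cong₂ _⊓_ (leaves-balanced (s≤s z≤n)) (leaves-balanced (≤-trans (s≤s z≤n) (halves-≤ h))))
              (m≤n⇒m⊓n≡m (halves-≤ h))

halves-suc : ∀ {p q} → Halves p q → Halves q (suc p)
halves-suc even = odd
halves-suc odd  = even

-- Adding halves componentwise gives the halves of the sum unless both numbers
-- are odd; then the crosswise pairing of halves-crossed does.
halves-+ : ∀ {x₁ x₂ y₁ y₂} → Halves x₁ x₂ → Halves y₁ y₂ →
           Halves (x₁ + y₁) (x₂ + y₂) ⊎ (x₂ ≡ suc x₁ × y₂ ≡ suc y₁)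
halves-+             even even = inj₁ even
halves-+ {x} {y₁ = y} even odd  = inj₁ (subst (Halves (x + y)) (sym (+-suc x y)) odd)
halves-+             odd  even = inj₁ odd
halves-+             odd  odd  = inj₂ (refl , refl)

halves-crossed : ∀ x y → Halves (x + suc y) (suc x + y)
halves-crossed x y = subst (Halves (x + suc y)) (+-suc x y) even

halves-pos : ∀ {p q} → Halves p q → 2 ≤ p + q → 1 ≤ p
halves-pos {zero}  even ()
halves-pos {zero}  odd  (s≤s ())
halves-pos {suc p} _    _        = s≤s z≤n

halves-⌊/2⌋ : ∀ {p q} → Halves p q → ⌊ p + q /2⌋ ≡ p
halves-⌊/2⌋ {p} even = sym (n≡⌊n+n/2⌋ p)
halves-⌊/2⌋ {p} odd  = trans (cong ⌊_/2⌋ (+-suc p p)) (sym (n≡⌈n+n/2⌉ p))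

halves-⌈/2⌉ : ∀ {p q} → Halves p q → ⌈ p + q /2⌉ ≡ q
halves-⌈/2⌉ {p} even = sym (n≡⌈n+n/2⌉ p)
halves-⌈/2⌉ {p} odd  = trans (cong ⌈_/2⌉ (+-suc p p)) (cong suc (sym (n≡⌊n+n/2⌋ p)))

halves-mono : ∀ {x₁ x₂ y₁ y₂} → Halves x₁ x₂ → Halves y₁ y₂ →
              x₁ + x₂ ≤ y₁ + y₂ → x₁ ≤ y₁ × x₂ ≤ y₂
halves-mono hx hy le =
  subst₂ _≤_ (halves-⌊/2⌋ hx) (halves-⌊/2⌋ hy) (⌊n/2⌋-mono le) ,
  subst₂ _≤_ (halves-⌈/2⌉ hx) (halves-⌈/2⌉ hy) (⌈n/2⌉-mono le)

halves-< : ∀ {n p q} → n ≡ p + q → Halves p q → 1 ≤ p → p < n × q < n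
halves-< {p = p} {q} refl h 1≤p = m<m+n p (≤-trans 1≤p (halves-≤ h)) , m<n+m q 1≤p

crossed-sum : ∀ x y → (x + suc x) + (y + suc y) ≡ (x + suc y) + (suc x + y)
crossed-sum = solve-∀

SackinBound : ℕ → ℕ → Set
SackinBound a b = sackinᵇ (a + b) ≤ a + b + sackinᵇ a + sackinᵇ b

sackinBound-comm : ∀ {a b} → SackinBound a b → SackinBound b a
sackinBound-comm {a} {b} = subst₂ _≤_ (cong sackinᵇ (+-comm a b)) (swap a b (sackinᵇ a) (sackinᵇ b))
  where
  swap : ∀ a b x y → a + b + x + y ≡ b + a + y + x
  swap = solve-∀

-- sackinᵇ 1 = 0 breaks the recurrence sackinᵇ n = n + sackinᵇ p + sackinᵇ q,
-- so a summand 1 needs its own induction.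
sackinBound-one : ∀ b → SackinBound 1 b
sackinBound-one = <-rec (SackinBound 1) go
  where
  go : ∀ b → (∀ {c} → c < b → SackinBound 1 c) → SackinBound 1 b
  go b ih with halving b
  ... | split zero _ even = z≤n
  ... | split zero _ odd  = ≤-refl
  ... | split p@(suc _) q h = begin
    sackinᵇ (suc (p + q))
      ≡⟨ sackinᵇ-halves (halves-suc h) 1≤q (sym (+-suc-comm q p)) ⟩
    suc (p + q) + sackinᵇ q + sackinᵇ (suc p)
      ≤⟨ +-monoʳ-≤ (suc (p + q) + sackinᵇ q) (ih (proj₁ (halves-< refl h (s≤s z≤n)))) ⟩
    suc (p + q) + sackinᵇ q + (suc p + 0 + sackinᵇ p)
      ≤⟨ +-monoʳ-≤ (suc (p + q) + sackinᵇ q) (+-monoˡ-≤ (sackinᵇ p) suc-p≤p+q) ⟩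
    suc (p + q) + sackinᵇ q + (p + q + sackinᵇ p)
      ≡⟨ regroup (p + q) (sackinᵇ q) (sackinᵇ p) ⟩
    suc (p + q) + 0 + (p + q + sackinᵇ p + sackinᵇ q)
      ≡⟨ cong (suc (p + q) + 0 +_) (sym (sackinᵇ-halves h (s≤s z≤n) refl)) ⟩
    suc (p + q) + 0 + sackinᵇ (p + q) ∎
    where
    open ≤-Reasoning
    1≤q : 1 ≤ q
    1≤q = ≤-trans (s≤s z≤n) (halves-≤ h)
    +-suc-comm : ∀ m n → m + suc n ≡ suc (n + m)
    +-suc-comm m n = trans (+-suc m n) (cong suc (+-comm m n))
    suc-p≤p+q : suc p + 0 ≤ p + q
    suc-p≤p+q = subst (_≤ p + q) (sym (+-identityʳ (suc p))) (m<m+n p 1≤q)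
    regroup : ∀ n x y → suc n + x + (n + y) ≡ suc n + 0 + (n + y + x)
    regroup = solve-∀

sackinBound-small : ∀ {q} → Halves 0 q → ∀ b → SackinBound q b
sackinBound-small even b = m≤n+m (sackinᵇ b) (b + 0)
sackinBound-small odd  b = sackinBound-one b

sackinBound-step : ∀ {a b x₁ x₂ y₁ y₂} →
  sackinᵇ a ≡ a + sackinᵇ x₁ + sackinᵇ x₂ →
  sackinᵇ b ≡ b + sackinᵇ y₁ + sackinᵇ y₂ →
  a + b ≡ (x₁ + y₁) + (x₂ + y₂) →
  sackinᵇ (a + b) ≡ a + b + sackinᵇ (x₁ + y₁) + sackinᵇ (x₂ + y₂) →
  SackinBound x₁ y₁ → SackinBound x₂ y₂ → SackinBound a b
sackinBound-step {a} {b} {x₁} {x₂} {y₁} {y₂} sa sb sum sab ih₁ ih₂ = begin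
  s (a + b)
    ≡⟨ sab ⟩
  a + b + s (x₁ + y₁) + s (x₂ + y₂)
    ≤⟨ +-mono-≤ (+-monoʳ-≤ (a + b) ih₁) ih₂ ⟩
  a + b + (x₁ + y₁ + s x₁ + s y₁) + (x₂ + y₂ + s x₂ + s y₂)
    ≡⟨ regroup (a + b) x₁ x₂ y₁ y₂ (s x₁) (s x₂) (s y₁) (s y₂) ⟩
  a + b + ((x₁ + y₁) + (x₂ + y₂)) + (s x₁ + s x₂) + (s y₁ + s y₂)
    ≡⟨ cong (λ n → a + b + n + (s x₁ + s x₂) + (s y₁ + s y₂)) (sym sum) ⟩
  a + b + (a + b) + (s x₁ + s x₂) + (s y₁ + s y₂)
    ≡⟨ regroup′ a b (s x₁) (s x₂) (s y₁) (s y₂) ⟩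
  a + b + (a + s x₁ + s x₂) + (b + s y₁ + s y₂)
    ≡⟨ cong₂ (λ u v → a + b + u + v) (sym sa) (sym sb) ⟩
  a + b + s a + s b ∎
  where
  open ≤-Reasoning
  s : ℕ → ℕ
  s = sackinᵇ
  regroup : ∀ n x₁ x₂ y₁ y₂ u₁ u₂ v₁ v₂ →
    n + (x₁ + y₁ + u₁ + v₁) + (x₂ + y₂ + u₂ + v₂) ≡ n + ((x₁ + y₁) + (x₂ + y₂)) + (u₁ + u₂) + (v₁ + v₂)
  regroup = solve-∀
  regroup′ : ∀ a b u₁ u₂ v₁ v₂ → a + b + (a + b) + (u₁ + u₂) + (v₁ + v₂) ≡ a + b + (a + u₁ + u₂) + (b + v₁ + v₂)
  regroup′ = solve-∀

sackinBound : ∀ a b → SackinBound a b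
sackinBound a b = <-rec P go (a + b) {a} {b} refl
  where
  P : ℕ → Set
  P n = ∀ {a b} → a + b ≡ n → SackinBound a b
  go : ∀ n → (∀ {m} → m < n → P m) → P n
  go _ rec {a} {b} refl with halving a | halving b
  ... | split zero _ hx | _ = sackinBound-small hx b
  ... | split (suc x) x₂ _ | split zero _ hy = sackinBound-comm {b} {suc x + x₂} (sackinBound-small hy (suc x + x₂))
  ... | split x₁@(suc _) x₂ hx | split y₁@(suc _) y₂ hy with halves-+ hx hy
  ...   | inj₁ hc = sackinBound-step {x₁ + x₂} {y₁ + y₂} {x₁} {x₂} {y₁} {y₂}
          (sackinᵇ-halves hx (s≤s z≤n) refl) (sackinᵇ-halves hy (s≤s z≤n) refl)
          sum (sackinᵇ-halves hc (s≤s z≤n) sum)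
          (rec (proj₁ smaller) {x₁} {y₁} refl) (rec (proj₂ smaller) {x₂} {y₂} refl)
    where
    sum : (x₁ + x₂) + (y₁ + y₂) ≡ (x₁ + y₁) + (x₂ + y₂)
    sum = interchange x₁ x₂ y₁ y₂
    smaller : x₁ + y₁ < x₁ + x₂ + (y₁ + y₂) × x₂ + y₂ < x₁ + x₂ + (y₁ + y₂)
    smaller = halves-< sum hc (s≤s z≤n)
  ...   | inj₂ (refl , refl) = sackinBound-step {x₁ + suc x₁} {y₁ + suc y₁} {x₁} {suc x₁} {suc y₁} {y₁}
          (sackinᵇ-halves hx (s≤s z≤n) refl) sb
          sum (sackinᵇ-halves (halves-crossed x₁ y₁) (s≤s z≤n) sum)
          (rec (proj₁ smaller) {x₁} {suc y₁} refl) (rec (proj₂ smaller) {suc x₁} {y₁} refl)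
    where
    sum : (x₁ + suc x₁) + (y₁ + suc y₁) ≡ (x₁ + suc y₁) + (suc x₁ + y₁)
    sum = crossed-sum x₁ y₁
    smaller : x₁ + suc y₁ < x₁ + suc x₁ + (y₁ + suc y₁) × suc x₁ + y₁ < x₁ + suc x₁ + (y₁ + suc y₁)
    smaller = halves-< sum (halves-crossed x₁ y₁) (s≤s z≤n)
    sb : sackinᵇ (y₁ + suc y₁) ≡ y₁ + suc y₁ + sackinᵇ (suc y₁) + sackinᵇ y₁
    sb = trans (sackinᵇ-halves hy (s≤s z≤n) refl) (xy∙z≈xz∙y (y₁ + suc y₁) (sackinᵇ y₁) (sackinᵇ (suc y₁)))

MinSumBound : ℕ → ℕ → Set
MinSumBound a b = a + a + minSumᵇ a + minSumᵇ b ≤ minSumᵇ (a + b)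

minSumBound-diag : ∀ a → MinSumBound a a
minSumBound-diag a = ≤-reflexive (sym (minSumᵇ-halves (even {a}) refl))

minSumBound-straight : ∀ {x₁ x₂ y₁ y₂} → Halves x₁ x₂ → Halves y₁ y₂ → Halves (x₁ + y₁) (x₂ + y₂) →
  MinSumBound x₁ y₁ → MinSumBound x₂ y₂ → MinSumBound (x₁ + x₂) (y₁ + y₂)
minSumBound-straight {x₁} {x₂} {y₁} {y₂} hx hy hc ih₁ ih₂ = begin
  (x₁ + x₂) + (x₁ + x₂) + m (x₁ + x₂) + m (y₁ + y₂)
    ≡⟨ cong₂ (λ u v → (x₁ + x₂) + (x₁ + x₂) + u + v) (minSumᵇ-halves hx refl) (minSumᵇ-halves hy refl) ⟩
  (x₁ + x₂) + (x₁ + x₂) + (x₁ + x₁ + m x₁ + m x₂) + (y₁ + y₁ + m y₁ + m y₂)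
    ≡⟨ regroup x₁ x₂ y₁ y₂ (m x₁) (m x₂) (m y₁) (m y₂) ⟩
  (x₁ + y₁) + (x₁ + y₁) + (x₁ + x₁ + m x₁ + m y₁) + (x₂ + x₂ + m x₂ + m y₂)
    ≤⟨ +-mono-≤ (+-monoʳ-≤ ((x₁ + y₁) + (x₁ + y₁)) ih₁) ih₂ ⟩
  (x₁ + y₁) + (x₁ + y₁) + m (x₁ + y₁) + m (x₂ + y₂)
    ≡⟨ sym (minSumᵇ-halves hc (interchange x₁ x₂ y₁ y₂)) ⟩
  m ((x₁ + x₂) + (y₁ + y₂)) ∎
  where
  open ≤-Reasoning
  m : ℕ → ℕ
  m = minSumᵇ
  regroup : ∀ x₁ x₂ y₁ y₂ u₁ u₂ v₁ v₂ →
    (x₁ + x₂) + (x₁ + x₂) + (x₁ + x₁ + u₁ + u₂) + (y₁ + y₁ + v₁ + v₂) ≡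
    (x₁ + y₁) + (x₁ + y₁) + (x₁ + x₁ + u₁ + v₁) + (x₂ + x₂ + u₂ + v₂)
  regroup = solve-∀

-- Pairing the halves crosswise makes the halves of the sum equal and gains 2.
minSumBound-crossed : ∀ x y → MinSumBound x (suc y) → MinSumBound (suc x) y →
                      MinSumBound (x + suc x) (y + suc y)
minSumBound-crossed x y ih₁ ih₂ = begin
  (x + suc x) + (x + suc x) + m (x + suc x) + m (y + suc y)
    ≡⟨ cong₂ (λ u v → (x + suc x) + (x + suc x) + u + v)
             (minSumᵇ-halves (odd {x}) refl) (minSumᵇ-halves (odd {y}) refl) ⟩
  (x + suc x) + (x + suc x) + (x + x + m x + m (suc x)) + (y + y + m y + m (suc y))
    ≤⟨ m≤m+n _ 2 ⟩
  (x + suc x) + (x + suc x) + (x + x + m x + m (suc x)) + (y + y + m y + m (suc y)) + 2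
    ≡⟨ regroup x y (m x) (m (suc x)) (m y) (m (suc y)) ⟩
  (x + suc y) + (x + suc y) + (x + x + m x + m (suc y)) + (suc x + suc x + m (suc x) + m y)
    ≤⟨ +-mono-≤ (+-monoʳ-≤ ((x + suc y) + (x + suc y)) ih₁) ih₂ ⟩
  (x + suc y) + (x + suc y) + m (x + suc y) + m (suc x + y)
    ≡⟨ sym (minSumᵇ-halves (halves-crossed x y) (crossed-sum x y)) ⟩
  m ((x + suc x) + (y + suc y)) ∎
  where
  open ≤-Reasoning
  m : ℕ → ℕ
  m = minSumᵇ
  regroup : ∀ x y u₁ u₂ v₁ v₂ →
    (x + suc x) + (x + suc x) + (x + x + u₁ + u₂) + (y + y + v₁ + v₂) + 2 ≡
    (x + suc y) + (x + suc y) + (x + x + u₁ + v₂) + (suc x + suc x + u₂ + v₁)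
  regroup = solve-∀

minSumBound : ∀ {a b} → a ≤ b → MinSumBound a b
minSumBound {a} {b} = <-rec P go (a + b) {a} {b} refl
  where
  P : ℕ → Set
  P n = ∀ {a b} → a + b ≡ n → a ≤ b → MinSumBound a b
  go : ∀ n → (∀ {m} → m < n → P m) → P n
  go _ rec {a} {b} refl a≤b with halving a | halving b
  ... | split _ zero even | _ = ≤-refl
  ... | split x₁ x₂@(suc _) hx | split y₁ y₂ hy with halves-+ hx hy
  ...   | inj₁ hc = minSumBound-straight hx hy hc
          (rec (proj₁ smaller) {x₁} {y₁} refl (proj₁ (halves-mono hx hy a≤b)))
          (rec (proj₂ smaller) {x₂} {y₂} refl (proj₂ (halves-mono hx hy a≤b)))
    where
    sum : (x₁ + x₂) + (y₁ + y₂) ≡ (x₁ + y₁) + (x₂ + y₂)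
    sum = interchange x₁ x₂ y₁ y₂
    1≤a : 1 ≤ x₁ + x₂
    1≤a = ≤-trans (s≤s z≤n) (m≤n+m x₂ x₁)
    smaller : x₁ + y₁ < x₁ + x₂ + (y₁ + y₂) × x₂ + y₂ < x₁ + x₂ + (y₁ + y₂)
    smaller = halves-< sum hc (halves-pos hc (subst (2 ≤_) sum (+-mono-≤ 1≤a (≤-trans 1≤a a≤b))))
  ...   | inj₂ (refl , refl) with m≤n⇒m<n∨m≡n (proj₁ (halves-mono hx hy a≤b))
  ...     | inj₂ refl = minSumBound-diag (x₁ + x₂)
  ...     | inj₁ x₁<y₁ = minSumBound-crossed x₁ y₁
            (rec (proj₁ smaller) {x₁} {suc y₁} refl (m≤n⇒m≤1+n (<⇒≤ x₁<y₁)))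
            (rec (proj₂ smaller) {suc x₁} {y₁} refl x₁<y₁)
    where
    smaller : x₁ + suc y₁ < x₁ + suc x₁ + (y₁ + suc y₁) × suc x₁ + y₁ < x₁ + suc x₁ + (y₁ + suc y₁)
    smaller = halves-< (crossed-sum x₁ y₁) (halves-crossed x₁ y₁) (≤-trans (s≤s z≤n) (m≤n+m (suc y₁) x₁))

minSumBound-⊓ : ∀ a b → (a ⊓ b) + (a ⊓ b) + minSumᵇ a + minSumᵇ b ≤ minSumᵇ (a + b)
minSumBound-⊓ a b with ≤-total a b
... | inj₁ a≤b rewrite m≤n⇒m⊓n≡m a≤b = minSumBound a≤b
... | inj₂ b≤a rewrite m≥n⇒m⊓n≡n b≤a =
  subst₂ _≤_ (swap b (minSumᵇ b) (minSumᵇ a)) (cong minSumᵇ (+-comm b a)) (minSumBound b≤a)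
  where
  swap : ∀ b x y → b + b + x + y ≡ b + b + y + x
  swap = solve-∀

sackin-balanced-≤ : ∀ T → sackinᵇ (leaves T) ≤ sackin T
sackin-balanced-≤ leaf       = z≤n
sackin-balanced-≤ (node l r) =
  ≤-trans (sackinBound (leaves l) (leaves r))
          (+-mono-≤ (+-monoʳ-≤ (leaves l + leaves r) (sackin-balanced-≤ l)) (sackin-balanced-≤ r))

minSum-≤-balanced : ∀ T → minSum T ≤ minSumᵇ (leaves T)
minSum-≤-balanced leaf       = z≤n
minSum-≤-balanced (node l r) =
  ≤-trans (+-mono-≤ (+-monoʳ-≤ μ (minSum-≤-balanced l)) (minSum-≤-balanced r))
          (minSumBound-⊓ (leaves l) (leaves r))
  where
  μ : ℕ
  μ = (leaves l ⊓ leaves r) + (leaves l ⊓ leaves r)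

proposition3 : (n : ℕ) (T : BinTree) → leaves T ≡ n →
    CollessMinimal n T → SackinMinimal n T
proposition3 _ T refl collessMin T′ sameLeaves = begin
  sackin T                             ≡⟨ sackin≡colless+minSum T ⟩
  colless T + minSum T                 ≤⟨ +-mono-≤ (collessMin B (leaves-balanced (1≤leaves T)))
                                                   (minSum-≤-balanced T) ⟩
  colless B + minSumᵇ (leaves T)       ≡⟨ sym (sackin≡colless+minSum B) ⟩
  sackinᵇ (leaves T)                   ≡⟨ cong sackinᵇ (sym sameLeaves) ⟩
  sackinᵇ (leaves T′)                  ≤⟨ sackin-balanced-≤ T′ ⟩
  sackin T′                            ∎
  where
  open ≤-Reasoning
  B : BinTree
  B = balanced (leaves T)
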